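{- For every matrix $A$ over $\mathbb F_2$, identifying the variable nodes of $G(A^\top)$ with the check nodes of $G(A)$ and vice versa (so that $G(A^\top)$ and $G(A)$ are the same bipartite graph with the roles of the two sides exchanged), we have $V_{\mathtt s}(A^\top)=C_{\mathtt s}(A)$ and $C_{\mathtt s}(A^\top)=V_{\mathtt s}(A)$.
   Context: Tanner graph $G(A)$ of an $m\times n$ matrix $A$: bipartite graph with variable nodes $v_1,\dots,v_n$ (columns), check nodes $a_1,\dots,a_m$ (rows), edge $a_iv_j$ iff $A_{ij}=1$; $\partial u$ denotes neighbourhood. Warning Propagation (WP): each edge $\{v,a\}$ carries messages $w_{v\to a},w_{a\to v}\in\{\mathtt f,\mathtt s,\mathtt u\}$. One round maps $w$ to $\hat w$: $\hat w_{a\to v}=\mathtt f$ if $w_{y\to a}=\mathtt f$ for all $y\in\partial a\setminus\{v\}$, $=\mathtt u$ if $w_{y\to a}=\mathtt u$ for some $y\in\partial a\setminus\{v\}$, $=\mathtt s$ otherwise; $\hat w_{v\to a}=\mathtt u$ if $\hat w_{b\to v}=\mathtt u$ for all $b\in\partial v\setminus\{a\}$, $=\mathtt f$ if $\hat w_{b\to v}=\mathtt f$ for some $b\in\partial v\setminus\{a\}$, $=\mathtt s$ otherwise. $w(A)$ is the pointwise limit of the iteration started from all-$\mathtt s$ messages. $V_{\mathtt s}(A)$ is the set of variable nodes $v$ with $w_{a\to v}(A)\ne\mathtt f$ for all $a\in\partial v$ and $w_{a\to v}(A)=\mathtt s$ for at least two $a\in\partial v$; $C_{\mathtt s}(A)$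 is the set of check nodes $a$ with $w_{v\to a}(A)\ne\mathtt u$ for all $v\in\partial a$ and $w_{v\to a}(A)=\mathtt s$ for at least two $v\in\partial a$. -}

module Defs where

open import Data.Bool using (Bool; true; false; _∧_; _∨_; not; if_then_else_)
open import Data.Nat using (ℕ; zero; suc; _≤_)
open import Data.Fin using (Fin; _≟_)
open import Data.List using (allFin)
open import Data.Bool.ListAction using (all; any)
open import Data.Product using (_×_; ∃; ∃-syntax)
open import Relation.Nullary using (¬_)
open import Relation.Nullary.Decidable using (⌊_⌋)
open import Relation.Binary.PropositionalEquality using (_≡_; _≢_)

-- An m × n matrix over F₂: entry A i j ∈ {0,1} encoded as Bool (true = 1).
Matrix : ℕ → ℕ → Set
Matrix m n = Fin m → Fin n → Bool

transpose : ∀ {m n} → Matrix m n → Matrix n m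
transpose A j i = A i j

data Msg : Set where
  f s u : Msg

isF isU : Msg → Bool
isF f = true
isF _ = false
isU u = true
isU _ = false

-- Messages on the Tanner graph G(A), indexed by (check a_i, variable v_j).
-- Edge a_i v_j iff A i j = true.  Entries at non-edges are kept at s
-- (they are never read).
record WPState (m n : ℕ) : Set where
  constructor ⟨_,_⟩
  field
    v→a : Fin m → Fin n → Msg
    a→v : Fin m → Fin n → Msg
open WPState public

allOthers anyOthers : ∀ {k} → (Fin k → Bool) → Fin k → (Fin k → Bool) → Bool
allOthers {k} adj x p = all (λ y → not (adj y ∧ not ⌊ y ≟ x ⌋) ∨ p y) (allFin k)
anyOthers {k} adj x p = any (λ y → adj y ∧ not ⌊ y ≟ x ⌋ ∧ p y) (allFin k)

checkUpd : ∀ {m n} → Matrix m n → (Fin m → Fin n → Msg) → Fin m → Fin n → Msg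
checkUpd A w i j =
  if allOthers (A i) j (λ y → isF (w i y)) then f
  else if anyOthers (A i) j (λ y → isU (w i y)) then u
  else s

varUpd : ∀ {m n} → Matrix m n → (Fin m → Fin n → Msg) → Fin m → Fin n → Msg
varUpd A ŵ i j =
  if allOthers (λ b → A b j) i (λ b → isU (ŵ b j)) then u
  else if anyOthers (λ b → A b j) i (λ b → isF (ŵ b j)) then f
  else s

onEdges : ∀ {m n} → Matrix m n → (Fin m → Fin n → Msg) → Fin m → Fin n → Msg
onEdges A w i j = if A i j then w i j else s

wpRound : ∀ {m n} → Matrix m n → WPState m n → WPState m n
wpRound A w = ⟨ onEdges A (varUpd A ŵ) , ŵ ⟩
  where
  ŵ = onEdges A (checkUpd A (v→a w))

allS : ∀ {m n} → WPState m n
allS = ⟨ (λ _ _ → s) , (λ _ _ → s) ⟩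

wpIter : ∀ {m n} → Matrix m n → ℕ → WPState m n
wpIter A zero = allS
wpIter A (suc t) = wpRound A (wpIter A t)

-- w is the pointwise limit of the WP iteration started from all-s
-- (for messages in a finite set: every entry is eventually constant).
IsWPLimit : ∀ {m n} → Matrix m n → WPState m n → Set
IsWPLimit A w =
  ∀ i j → ∃[ T ] (∀ t → T ≤ t →
     (v→a (wpIter A t) i j ≡ v→a w i j) × (a→v (wpIter A t) i j ≡ a→v w i j))

InVs : ∀ {m n} → Matrix m n → WPState m n → Fin n → Set
InVs A w j =
  (∀ i → A i j ≡ true → a→v w i j ≢ f) ×
  ∃[ i ] ∃[ i' ] (i ≢ i' × A i j ≡ true × A i' j ≡ true ×
                  a→v w i j ≡ s × a→v w i' j ≡ s)

InCs : ∀ {m n} → Matrix m n → WPState m n → Fin m → Set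
InCs A w i =
  (∀ j → A i j ≡ true → v→a w i j ≢ u) ×
  ∃[ j ] ∃[ j' ] (j ≢ j' × A i j ≡ true × A i j' ≡ true ×
                  v→a w i j ≡ s × v→a w i j' ≡ s)

-- Warning Propagation on G(Aᵀ) is Warning Propagation on G(A) with f and u exchanged
-- and with the variable half-round performed first. Both update rules are monotone for
-- the order putting s below f and u, and both runs start from all-s messages, so the
-- two runs interleave: each stage of one lies between two consecutive stages of the
-- other. Hence their limits agree up to exchanging f and u, an exchange under which
-- the defining conditions of V_s and C_s correspond.
module Submission where

open import Defs
open import Level using (Level)
open import Data.Bool using (Bool; true; false; T; not; _∧_; _∨_; if_then_else_)
open import Data.Empty using (⊥; ⊥-elim)
open import Data.Unit using (tt)
open import Data.Fin using (Fin; _≟_)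
open import Data.List using (allFin)
open import Data.Bool.ListAction using (and; or)
open import Data.List.Properties using (map-cong)
open import Data.List.Relation.Unary.All as All using (All)
open import Data.List.Relation.Unary.All.Properties using (all⁺; all⁻)
open import Data.List.Relation.Unary.Any.Properties using (any⁺; any⁻)
import Data.List.Relation.Unary.Any as Any
open import Data.Nat using (ℕ; zero; suc; _≤_; _⊔_)
open import Data.Nat.GeneralisedArithmetic using (fold)
open import Data.Nat.Properties using (m≤m⊔n; m≤n⊔m; ≤-trans; n≤1+n)
open import Data.Product using (_×_; _,_; proj₁; proj₂; ∃-syntax; map₂)
open import Function using (_∘_; _⇔_; mk⇔)
open import Relation.Binary.Core using (Rel; _Preserves_⟶_)
open import Relation.Binary.Definitions using (Antisymmetric; Minimum)
open import Relation.Binary.PropositionalEquality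
open import Relation.Nullary.Decidable using (⌊_⌋)

private
  variable
    a ℓ : Level
    k m n : ℕ
    X Y : Set a

module _ (_≤_ : Rel X ℓ) where

  fold-mono : ∀ {g : X → X} → g Preserves _≤_ ⟶ _≤_ →
              ∀ {x y} → x ≤ y → ∀ t → fold x g t ≤ fold y g t
  fold-mono g-mono x≤y zero    = x≤y
  fold-mono g-mono x≤y (suc t) = g-mono (fold-mono g-mono x≤y t)

  fold-∘-roll : ∀ (F G : X → X) x t → fold (F x) (F ∘ G) t ≡ F (fold x (G ∘ F) t)
  fold-∘-roll F G x zero    = refl
  fold-∘-roll F G x (suc t) = cong (F ∘ G) (fold-∘-roll F G x t)

  fold-∘-interleave : ∀ {F G : X → X} →
    F Preserves _≤_ ⟶ _≤_ → G Preserves _≤_ ⟶ _≤_ → ∀ {x₀ : X} → Minimum _≤_ x₀ →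
    ∀ t → fold x₀ (F ∘ G) t ≤ F (fold x₀ (G ∘ F) t) ×
          F (fold x₀ (G ∘ F) t) ≤ fold x₀ (F ∘ G) (suc t)
  fold-∘-interleave {F} {G} F-mono G-mono {x₀} x₀-min t =
    subst (fold x₀ (F ∘ G) t ≤_) (fold-∘-roll F G x₀ t)
          (fold-mono (F-mono ∘ G-mono) (x₀-min (F x₀)) t) ,
    F-mono (subst (fold x₀ (G ∘ F) t ≤_) (fold-∘-roll G F x₀ t)
                  (fold-mono (G-mono ∘ F-mono) (x₀-min (G x₀)) t))

Converges : (ℕ → X) → X → Set _
Converges x α = ∃[ T ] (∀ t → T ≤ t → x t ≡ α)

converges-cong : ∀ {x y : ℕ → X} {α} → (∀ t → x t ≡ y t) → Converges x α → Converges y α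
converges-cong x≡y = map₂ λ h t T≤t → trans (sym (x≡y t)) (h t T≤t)

converges-map : ∀ (g : X → Y) {x α} → Converges x α → Converges (g ∘ x) (g α)
converges-map g = map₂ λ h t T≤t → cong g (h t T≤t)

converges-suc : ∀ {x : ℕ → X} {α} → Converges x α → Converges (x ∘ suc) α
converges-suc = map₂ λ h t T≤t → h (suc t) (≤-trans T≤t (n≤1+n t))

module _ {_≤_ : Rel X ℓ} (antisym : Antisymmetric _≡_ _≤_) where

  interleaved-limits-equal : ∀ {x y : ℕ → X} {α β} →
    (∀ t → x t ≤ y t) → (∀ t → y t ≤ x (suc t)) →
    Converges x α → Converges y β → α ≡ β
  interleaved-limits-equal x≤y y≤x′ (T₁ , x→α) (T₂ , y→β) =
    antisym (subst₂ _≤_ (x→α t T₁≤t) (y→β t T₂≤t) (x≤y t))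
            (subst₂ _≤_ (y→β t T₂≤t) (x→α (suc t) (≤-trans T₁≤t (n≤1+n t))) (y≤x′ t))
    where
    t = T₁ ⊔ T₂
    T₁≤t = m≤m⊔n T₁ T₂
    T₂≤t = m≤n⊔m T₁ T₂

flip : Msg → Msg
flip f = u
flip u = f
flip s = s

flip-involutive : ∀ x → flip (flip x) ≡ x
flip-involutive f = refl
flip-involutive u = refl
flip-involutive s = refl

flip-injective : ∀ {x y} → flip x ≡ flip y → x ≡ y
flip-injective {x} {y} e = trans (sym (flip-involutive x)) (trans (cong flip e) (flip-involutive y))

flip-swap : ∀ {x y} → x ≡ flip y → flip x ≡ y
flip-swap {x} {y} e = trans (cong flip e) (flip-involutive y)

≡flip-sym : ∀ {x y} → x ≡ flip y → y ≡ flip x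
≡flip-sym e = sym (flip-swap e)

isF-flip : ∀ x → isF (flip x) ≡ isU x
isF-flip f = refl
isF-flip u = refl
isF-flip s = refl

isU-flip : ∀ x → isU (flip x) ≡ isF x
isU-flip f = refl
isU-flip u = refl
isU-flip s = refl

flip-if : ∀ b b′ x y →
  flip (if b then x else if b′ then y else s) ≡ (if b then flip x else if b′ then flip y else s)
flip-if true  _     x y = refl
flip-if false true  x y = refl
flip-if false false x y = refl

data _⊑_ : Msg → Msg → Set where
  s⊑ : ∀ {x} → s ⊑ x
  ⊑-refl : ∀ {x} → x ⊑ x

⊑-antisym : Antisymmetric _≡_ _⊑_
⊑-antisym s⊑     s⊑     = refl
⊑-antisym s⊑     ⊑-refl = refl
⊑-antisym ⊑-refl _      = refl

isF-mono : ∀ {x y} → x ⊑ y → T (isF x) → T (isF y)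
isF-mono ⊑-refl p = p

isU-mono : ∀ {x y} → x ⊑ y → T (isU x) → T (isU y)
isU-mono ⊑-refl p = p

isF-isU-disjoint : ∀ x → T (isF x) → T (isU x) → ⊥
isF-isU-disjoint f _ ()

isU-isF-disjoint : ∀ x → T (isU x) → T (isF x) → ⊥
isU-isF-disjoint u _ ()

if-mono : ∀ {b₁ b₂ b₁′ b₂′} x y → (T b₁ → T b₁′) → (T b₂ → T b₂′) → (T b₁′ → T b₂′ → ⊥) →
  (if b₁ then x else if b₂ then y else s) ⊑ (if b₁′ then x else if b₂′ then y else s)
if-mono {true}  {_}    {true}  {_}     x y h₁ h₂ excl = ⊑-refl
if-mono {true}  {_}    {false} {_}     x y h₁ h₂ excl = ⊥-elim (h₁ tt)
if-mono {false} {true} {true}  {true}  x y h₁ h₂ excl = ⊥-elim (excl tt tt)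
if-mono {false} {true} {false} {true}  x y h₁ h₂ excl = ⊑-refl
if-mono {false} {true} {_}     {false} x y h₁ h₂ excl = ⊥-elim (h₂ tt)
if-mono {false} {false}                x y h₁ h₂ excl = s⊑

guarded-all-mono : ∀ c {b b′} → (T b → T b′) → T (not c ∨ b) → T (not c ∨ b′)
guarded-all-mono true  h = h
guarded-all-mono false h = λ _ → tt

guarded-any-mono : ∀ c d {b b′} → (T b → T b′) → T (c ∧ d ∧ b) → T (c ∧ d ∧ b′)
guarded-any-mono true  true  h = h
guarded-any-mono true  false h = λ ()
guarded-any-mono false _     h = λ ()

guarded-disjoint : ∀ c d {b b′} → (T b → T b′ → ⊥) → T (not (c ∧ d) ∨ b) → T (c ∧ d ∧ b′) → ⊥
guarded-disjoint true  true  h = h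
guarded-disjoint true  false h _ ()
guarded-disjoint false _     h _ ()

module _ (adj : Fin k → Bool) (x : Fin k) where

  private
    distinct : Fin k → Bool
    distinct y = not ⌊ y ≟ x ⌋

  allOthers-cong : ∀ {p q : Fin k → Bool} → (∀ y → p y ≡ q y) →
                   allOthers adj x p ≡ allOthers adj x q
  allOthers-cong p≗q = cong and
    (map-cong (λ y → cong (not (adj y ∧ distinct y) ∨_) (p≗q y)) (allFin k))

  anyOthers-cong : ∀ {p q : Fin k → Bool} → (∀ y → p y ≡ q y) →
                   anyOthers adj x p ≡ anyOthers adj x q
  anyOthers-cong p≗q = cong or
    (map-cong (λ y → cong (λ b → adj y ∧ distinct y ∧ b) (p≗q y)) (allFin k))

  allOthers-mono : ∀ {p q : Fin k → Bool} → (∀ y → T (p y) → T (q y)) →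
                   T (allOthers adj x p) → T (allOthers adj x q)
  allOthers-mono p⇒q =
    all⁻ _ ∘ All.map (λ {y} → guarded-all-mono (adj y ∧ distinct y) (p⇒q y)) ∘ all⁺ _ (allFin k)

  anyOthers-mono : ∀ {p q : Fin k → Bool} → (∀ y → T (p y) → T (q y)) →
                   T (anyOthers adj x p) → T (anyOthers adj x q)
  anyOthers-mono p⇒q =
    any⁺ _ ∘ Any.map (λ {y} → guarded-any-mono (adj y) (distinct y) (p⇒q y)) ∘ any⁻ _ (allFin k)

  allOthers-anyOthers-disjoint : ∀ {p q : Fin k → Bool} → (∀ y → T (p y) → T (q y) → ⊥) →
                                 T (allOthers adj x p) → T (anyOthers adj x q) → ⊥
  allOthers-anyOthers-disjoint p#q all-p any-q =
    All.lookupWith {R = λ _ → ⊥} (λ {y} → guarded-disjoint (adj y) (distinct y) (p#q y))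
                   (all⁺ _ (allFin k) all-p) (any⁻ _ (allFin k) any-q)

update-cong : ∀ (adj : Fin k → Bool) x {p p′ q q′ : Fin k → Bool} c₁ c₂ →
  (∀ y → p y ≡ p′ y) → (∀ y → q y ≡ q′ y) →
  (if allOthers adj x p  then c₁ else if anyOthers adj x q  then c₂ else s) ≡
  (if allOthers adj x p′ then c₁ else if anyOthers adj x q′ then c₂ else s)
update-cong adj x c₁ c₂ p≗p′ q≗q′ =
  cong₂ (λ b b′ → if b then c₁ else if b′ then c₂ else s)
        (allOthers-cong adj x p≗p′) (anyOthers-cong adj x q≗q′)

update-mono : ∀ (adj : Fin k → Bool) x {p p′ q q′ : Fin k → Bool} c₁ c₂ →
  (∀ y → T (p y) → T (p′ y)) → (∀ y → T (q y) → T (q′ y)) → (∀ y → T (p′ y) → T (q′ y) → ⊥) →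
  (if allOthers adj x p  then c₁ else if anyOthers adj x q  then c₂ else s) ⊑
  (if allOthers adj x p′ then c₁ else if anyOthers adj x q′ then c₂ else s)
update-mono adj x c₁ c₂ p⇒p′ q⇒q′ p′#q′ =
  if-mono c₁ c₂ (allOthers-mono adj x p⇒p′) (anyOthers-mono adj x q⇒q′)
                (allOthers-anyOthers-disjoint adj x p′#q′)

Messages : ℕ → ℕ → Set
Messages m n = Fin m → Fin n → Msg

sMessages : Messages m n
sMessages _ _ = s

_⊑ᴹ_ : Rel (Messages m n) _
X ⊑ᴹ Y = ∀ i j → X i j ⊑ Y i j

sMessages-minimum : Minimum (_⊑ᴹ_ {m} {n}) sMessages
sMessages-minimum _ _ _ = s⊑

Dual : Messages m n → Messages n m → Set
Dual X Y = ∀ i j → Y j i ≡ flip (X i j)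

checkStep varStep : Matrix m n → Messages m n → Messages m n
checkStep A X = onEdges A (checkUpd A X)
varStep   A X = onEdges A (varUpd A X)

module _ (A : Matrix m n) where

  onEdges-mono : ∀ {X Y} → X ⊑ᴹ Y → onEdges A X ⊑ᴹ onEdges A Y
  onEdges-mono X⊑Y i j with A i j
  ... | true  = X⊑Y i j
  ... | false = ⊑-refl

  checkStep-mono : checkStep A Preserves _⊑ᴹ_ ⟶ _⊑ᴹ_
  checkStep-mono {X} {Y} X⊑Y = onEdges-mono λ i j →
    update-mono (A i) j f u (λ y → isF-mono (X⊑Y i y)) (λ y → isU-mono (X⊑Y i y))
                (λ y → isF-isU-disjoint (Y i y))

  varStep-mono : varStep A Preserves _⊑ᴹ_ ⟶ _⊑ᴹ_
  varStep-mono {X} {Y} X⊑Y = onEdges-mono λ i j →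
    update-mono (λ b → A b j) i u f (λ b → isU-mono (X⊑Y b j)) (λ b → isF-mono (X⊑Y b j))
                (λ b → isU-isF-disjoint (Y b j))

  onEdges-transpose : ∀ {X Y} → Dual X Y → Dual (onEdges A X) (onEdges (transpose A) Y)
  onEdges-transpose X~Y i j with A i j
  ... | true  = X~Y i j
  ... | false = refl

  checkStep-transpose : ∀ {X Y} → Dual X Y → Dual (varStep A X) (checkStep (transpose A) Y)
  checkStep-transpose {X} {Y} X~Y = onEdges-transpose λ i j → begin
    checkUpd (transpose A) Y j i
      ≡⟨ update-cong (λ b → A b j) i f u
           (λ b → trans (cong isF (X~Y b j)) (isF-flip (X b j)))
           (λ b → trans (cong isU (X~Y b j)) (isU-flip (X b j))) ⟩
    (if allOthers (λ b → A b j) i (λ b → isU (X b j)) then f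
     else if anyOthers (λ b → A b j) i (λ b → isF (X b j)) then u else s)
      ≡⟨ flip-if (allOthers (λ b → A b j) i (λ b → isU (X b j)))
                  (anyOthers (λ b → A b j) i (λ b → isF (X b j))) u f ⟨
    flip (varUpd A X i j) ∎
    where open ≡-Reasoning

  varStep-transpose : ∀ {X Y} → Dual X Y → Dual (checkStep A X) (varStep (transpose A) Y)
  varStep-transpose {X} {Y} X~Y = onEdges-transpose λ i j → begin
    varUpd (transpose A) Y j i
      ≡⟨ update-cong (A i) j u f
           (λ b → trans (cong isU (X~Y i b)) (isU-flip (X i b)))
           (λ b → trans (cong isF (X~Y i b)) (isF-flip (X i b))) ⟩
    (if allOthers (A i) j (λ b → isF (X i b)) then u
     else if anyOthers (A i) j (λ b → isU (X i b)) then f else s)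
      ≡⟨ flip-if (allOthers (A i) j (λ b → isF (X i b)))
                  (anyOthers (A i) j (λ b → isU (X i b))) f u ⟨
    flip (checkUpd A X i j) ∎
    where open ≡-Reasoning

module _ (A : Matrix m n) where

  v→a-wpIter : ∀ t → v→a (wpIter A t) ≡ fold sMessages (varStep A ∘ checkStep A) t
  v→a-wpIter zero    = refl
  v→a-wpIter (suc t) = cong (varStep A ∘ checkStep A) (v→a-wpIter t)

  v→a-wpIter-transpose :
    ∀ t → Dual (fold sMessages (checkStep A ∘ varStep A) t) (v→a (wpIter (transpose A) t))
  v→a-wpIter-transpose zero    _ _ = refl
  v→a-wpIter-transpose (suc t) =
    varStep-transpose A (checkStep-transpose A (v→a-wpIter-transpose t))

  module _ {w : WPState m n} (w-lim : IsWPLimit A w) where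

    v→a-converges : ∀ i j → Converges (λ t → v→a (wpIter A t) i j) (v→a w i j)
    v→a-converges i j = map₂ (λ h t T≤t → proj₁ (h t T≤t)) (w-lim i j)

    a→v-converges : ∀ i j → Converges (λ t → a→v (wpIter A t) i j) (a→v w i j)
    a→v-converges i j = map₂ (λ h t T≤t → proj₂ (h t T≤t)) (w-lim i j)

module _ (A : Matrix m n) {w : WPState m n} {wᵀ : WPState n m}
         (w-lim : IsWPLimit A w) (wᵀ-lim : IsWPLimit (transpose A) wᵀ) where

  v→a-limit-transpose : Dual (v→a w) (a→v wᵀ)
  v→a-limit-transpose i j = ≡flip-sym
    (interleaved-limits-equal ⊑-antisym (λ t → proj₁ (chain t) i j) (λ t → proj₂ (chain t) i j)
      (converges-cong (λ t → cong (λ X → X i j) (v→a-wpIter A t)) (v→a-converges A w-lim i j))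
      (converges-cong (λ t → flip-swap (checkStep-transpose A (v→a-wpIter-transpose A t) i j))
                      (converges-map flip (converges-suc (a→v-converges (transpose A) wᵀ-lim j i)))))
    where chain = fold-∘-interleave _⊑ᴹ_ (varStep-mono A) (checkStep-mono A) sMessages-minimum

  a→v-limit-transpose : Dual (a→v w) (v→a wᵀ)
  a→v-limit-transpose i j = ≡flip-sym (sym
    (interleaved-limits-equal ⊑-antisym (λ t → proj₁ (chain t) i j) (λ t → proj₂ (chain t) i j)
      (converges-cong (λ t → flip-swap (v→a-wpIter-transpose A t i j))
                      (converges-map flip (v→a-converges (transpose A) wᵀ-lim j i)))
      (converges-cong (λ t → cong (λ X → checkStep A X i j) (v→a-wpIter A t))
                      (converges-suc (a→v-converges A w-lim i j)))))
    where chain = fold-∘-interleave _⊑ᴹ_ (checkStep-mono A) (varStep-mono A) sMessages-minimum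

-- InVs A w j is SNode (λ i → A i j) (λ i → a→v w i j) f and
-- InCs A w i is SNode (A i) (λ j → v→a w i j) u.
SNode : (Fin k → Bool) → (Fin k → Msg) → Msg → Set
SNode adj x c =
  (∀ l → adj l ≡ true → x l ≢ c) ×
  ∃[ l ] ∃[ l′ ] (l ≢ l′ × adj l ≡ true × adj l′ ≡ true × x l ≡ s × x l′ ≡ s)

SNode-flip : ∀ {adj : Fin k → Bool} {x y c} → (∀ l → y l ≡ flip (x l)) →
             SNode adj y (flip c) ⇔ SNode adj x c
SNode-flip y≡flip-x = mk⇔
  (λ (y≢c , l , l′ , l≢l′ , adj-l , adj-l′ , yl≡s , yl′≡s) →
     (λ l adj-l xl≡c → y≢c l adj-l (trans (y≡flip-x l) (cong flip xl≡c))) ,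
     l , l′ , l≢l′ , adj-l , adj-l′ ,
     flip-injective (trans (sym (y≡flip-x l)) yl≡s) ,
     flip-injective (trans (sym (y≡flip-x l′)) yl′≡s))
  (λ (x≢c , l , l′ , l≢l′ , adj-l , adj-l′ , xl≡s , xl′≡s) →
     (λ l adj-l yl≡c → x≢c l adj-l (flip-injective (trans (sym (y≡flip-x l)) yl≡c))) ,
     l , l′ , l≢l′ , adj-l , adj-l′ ,
     trans (y≡flip-x l) (cong flip xl≡s) ,
     trans (y≡flip-x l′) (cong flip xl′≡s))

lemma7p2 : ∀ {m n} (A : Matrix m n) (w : WPState m n) (wᵀ : WPState n m) →
    IsWPLimit A w → IsWPLimit (transpose A) wᵀ →
    (∀ (i : Fin m) → InVs (transpose A) wᵀ i ⇔ InCs A w i) ×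
    (∀ (j : Fin n) → InCs (transpose A) wᵀ j ⇔ InVs A w j)
lemma7p2 A w wᵀ w-lim wᵀ-lim =
  (λ i → SNode-flip (λ j → v→a-limit-transpose A w-lim wᵀ-lim i j)) ,
  (λ j → SNode-flip (λ i → a→v-limit-transpose A w-lim wᵀ-lim i j))
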